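{- Let $\omega\in S_n$ and $1\le i<j\le n$. If $m_{i,p}(\omega)>m_{j,q}(\omega)$ for some $1\le p\le c_i(\omega)$ and $1\le q\le c_j(\omega)$, then $\{k: j<k,\ \omega(i)>\omega(k)\}\subseteq\{l: j<l,\ \omega(j)>\omega(l)\}$.
   Context: Permutations are in one-line notation. ${\rm Inv}(\omega)=\{(i,j): 1\le i<j\le n,\ \omega(i)>\omega(j)\}$; $c_i(\omega)=\#\{j>i: \omega(i)>\omega(j)\}$; for $i<j$, $c_{i,j}(\omega)=\#\{k: i<k<j,\ \omega(i)>\omega(k)\}$. For $c_i(\omega)>0$ and $1\le x\le c_i(\omega)$, $m_{i,x}(\omega)\in\mathbb{N}^n$ has $j$-th coordinate: $0$ if $(i,j)\in{\rm Inv}(\omega)$; $0$ if $j<i$; $x$ if $j=i$; $\max\{0,x-c_{i,j}(\omega)\}$ if $j>i$ and $(i,j)\notin{\rm Inv}(\omega)$. The order $>$ is the strict componentwise order on $\mathbb{N}^n$. -}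

module Defs where

open import Data.Nat using (ℕ; zero; suc; _∸_; _≤_)
open import Data.Fin using (Fin; _<_; _>_; _<?_)
open import Data.Fin.Permutation using (Permutation′; _⟨$⟩ʳ_)
open import Data.List using (List; length; filter)
open import Data.List using () renaming (allFin to allFinL)
open import Data.Product using (_×_; _,_)
open import Relation.Nullary using (¬_; Dec; yes; no)
open import Relation.Nullary.Decidable using (_×-dec_)
open import Relation.Binary.PropositionalEquality using (_≡_)

-- Permutations of {1..n} are represented 0-based as bijections Fin n ↔ Fin n;
-- ω(i) is  ω ⟨$⟩ʳ i .

Inv : ∀ {n} → Permutation′ n → Fin n → Fin n → Set
Inv ω i j = (i < j) × (ω ⟨$⟩ʳ i > ω ⟨$⟩ʳ j)

c : ∀ {n} → Permutation′ n → Fin n → ℕ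
c {n} ω i = length (filter (λ j → (i <? j) ×-dec (ω ⟨$⟩ʳ j <? ω ⟨$⟩ʳ i)) (allFinL n))

cc : ∀ {n} → Permutation′ n → Fin n → Fin n → ℕ
cc {n} ω i j = length (filter (λ k → (i <? k) ×-dec ((k <? j) ×-dec (ω ⟨$⟩ʳ k <? ω ⟨$⟩ʳ i))) (allFinL n))

m : ∀ {n} → Permutation′ n → Fin n → ℕ → Fin n → ℕ
m ω i x j with j <? i
... | yes _ = 0
... | no _ with i <? j
...   | no _ = x            -- j = i
...   | yes _ with ω ⟨$⟩ʳ j <? ω ⟨$⟩ʳ i
...     | yes _ = 0
...     | no _ = x ∸ cc ω i j   -- max{0, x - c_{i,j}(ω)}

_≥ᶜ_ : ∀ {n} → (Fin n → ℕ) → (Fin n → ℕ) → Set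
u ≥ᶜ v = ∀ k → v k ≤ u k

_>ᶜ_ : ∀ {n} → (Fin n → ℕ) → (Fin n → ℕ) → Set
u >ᶜ v = (u ≥ᶜ v) × ¬ (∀ k → u k ≡ v k)

-- Compare the j-th coordinates: if (i,j) were an inversion, m_{i,p}(ω) would vanish
-- there while m_{j,q}(ω) equals q ≥ 1. So m_{i,p}(ω) ≥ m_{j,q}(ω) forces ω(i) ≤ ω(j),
-- and ω(k) < ω(i) then gives ω(k) < ω(j).
module Submission where

open import Defs
open import Data.Nat using (ℕ; _≤_)
import Data.Nat.Properties as ℕ
open import Data.Fin using (Fin; _<_; _>_; _<?_) renaming (_≤_ to _≤ᶠ_)
open import Data.Fin.Permutation using (Permutation′; _⟨$⟩ʳ_)
open import Data.Fin.Properties using (<-irrefl)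
open import Data.Product using (Σ; _×_; _,_)
open import Data.Empty using (⊥-elim)
open import Relation.Nullary using (¬_; yes; no)
open import Relation.Binary.PropositionalEquality using (_≡_; refl)

module _ {n} (ω : Permutation′ n) where

  m-inversion≡0 : ∀ {i j} p → i < j → ω ⟨$⟩ʳ j < ω ⟨$⟩ʳ i → m ω i p j ≡ 0
  m-inversion≡0 {i} {j} p i<j ωj<ωi with j <? i
  ... | yes _ = refl
  ... | no _ with i <? j
  ...   | no i≮j = ⊥-elim (i≮j i<j)
  ...   | yes _ with ω ⟨$⟩ʳ j <? ω ⟨$⟩ʳ i
  ...     | yes _ = refl
  ...     | no ωj≮ωi = ⊥-elim (ωj≮ωi ωj<ωi)

  m-diagonal : ∀ j x → m ω j x j ≡ x
  m-diagonal j x with j <? j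
  ... | yes j<j = ⊥-elim (<-irrefl refl j<j)
  ... | no _ with j <? j
  ...   | no _ = refl
  ...   | yes j<j = ⊥-elim (<-irrefl refl j<j)

  ≥ᶜ⇒¬inversion : ∀ {i j p q} → i < j → 1 ≤ q →
                  m ω i p ≥ᶜ m ω j q → ¬ (ω ⟨$⟩ʳ j < ω ⟨$⟩ʳ i)
  ≥ᶜ⇒¬inversion {i} {j} {p} {q} i<j 1≤q m≥ ωj<ωi = ℕ.<-irrefl refl 1≤0
    where
    1≤0 : 1 ≤ 0
    1≤0 with m≥ j
    ... | h rewrite m-inversion≡0 p i<j ωj<ωi | m-diagonal j q = ℕ.≤-trans 1≤q h

  ≥ᶜ⇒ω-monotone : ∀ {i j p q} → i < j → 1 ≤ q →
                  m ω i p ≥ᶜ m ω j q → ω ⟨$⟩ʳ i ≤ᶠ ω ⟨$⟩ʳ j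
  ≥ᶜ⇒ω-monotone i<j 1≤q m≥ = ℕ.≮⇒≥ (≥ᶜ⇒¬inversion i<j 1≤q m≥)

mainTheorem4 : ∀ {n} (ω : Permutation′ n) (i j : Fin n) → i < j →
    Σ ℕ (λ p → Σ ℕ (λ q → (1 ≤ p) × (p ≤ c ω i) × (1 ≤ q) × (q ≤ c ω j)
    × (m ω i p >ᶜ m ω j q))) →
    ∀ (k : Fin n) → j < k → ω ⟨$⟩ʳ i > ω ⟨$⟩ʳ k → ω ⟨$⟩ʳ j > ω ⟨$⟩ʳ k
mainTheorem4 ω i j i<j (p , q , _ , _ , 1≤q , _ , m≥ , _) k _ ωk<ωi =
  ℕ.<-≤-trans ωk<ωi (≥ᶜ⇒ω-monotone ω i<j 1≤q m≥)
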